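{- Let $K$ be a field, $S=K[x_1,\ldots,x_n]$, and let $I=(u_1,\ldots,u_s)\subset S$ be a monomial ideal with $u_j=x_1^{a_{j1}}\cdots x_n^{a_{jn}}$, such that each variable $x_i$ divides some $u_j$. Set $r_i=\max\{a_{ji}: j=1,\ldots,s\}$ for $i=1,\ldots,n$. Let $\Gamma$ be the multicomplex associated to $I$ and let $\Gamma=\bigcup_{i=1}^t[a_i,b_i]$ be a nice partition of $\Gamma$ with $\mathcal{F}(\Gamma)=\{b_1,\ldots,b_t\}$. Then $a_i(j)\le r_j$ for all $i$ and $j$.
   Context: $\mathbb{N}_\infty=\mathbb{N}\cup\{\infty\}$ with $a\le\infty$ for all $a$; $\mathbb{N}_\infty^n$ carries the componentwise partial order. A multicomplex is a subset $\Gamma\subset\mathbb{N}_\infty^n$ closed under going down and such that every element lies below some maximal element; $\mathcal{M}(\Gamma)$ denotes the maximal elements. $\operatorname{infpt}(a)=\{i:a(i)=\infty\}$. A facet of $\Gamma$ is $a\in\Gamma$ with $\operatorname{infpt}(a)=\operatorname{infpt}(m)$ for all $m\in\mathcal{M}(\Gamma)$ with $a\le m$; $\mathcal{F}(\Gamma)$ is the set of facets. The multicomplex associated to a monomial ideal $I$ is the unique multicomplex $\Gamma$ such that $I$ is spanned by the monomials $x^a$ with $a\in\mathbb{N}^n\setminus\Gamma$. An interval is $[a,b]=\{c\in\Gamma:a\le c\le b\}$ with $a\le b$ in $\Gamma$; a partition is a presentation of $\Gamma$ as a finite disjoint union of intervals; it is nice if $|\operatorname{infpt}(b_i)|\ge\operatorname{depth}(S/I)$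 for all $i$. -}

module Defs where

open import Level using (Level; _⊔_) renaming (suc to lsuc)
open import Data.Nat using (ℕ; zero; suc; _+_; _≤_) renaming (_≟_ to _≟ℕ_; _⊔_ to _⊔ℕ_)
open import Data.Fin using (Fin; zero; suc)
import Data.Fin
open import Data.Fin.Subset using (Subset)
open import Data.Bool using (Bool; true; false; if_then_else_)
open import Data.Vec using (Vec; []; _∷_; tabulate; zipWith; replicate; lookup)
import Data.Vec.Properties as VecP
open import Data.List using (List; []; _∷_; _++_; map; concatMap; length; foldr; [_])
open import Data.List.Base using (allFin)
open import Data.Product using (Σ; ∃; _×_; _,_; proj₁; proj₂)
open import Relation.Nullary using (¬_; does)
open import Relation.Binary.PropositionalEquality using (_≡_)
open import Algebra.Bundles using (CommutativeRing)
open import Function using (_∘_; _⇔_)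

record Field (c ℓ : Level) : Set (lsuc (c ⊔ ℓ)) where
  field
    commutativeRing : CommutativeRing c ℓ
  open CommutativeRing commutativeRing public
  field
    0≉1     : ¬ (0# ≈ 1#)
    inverse : ∀ x → ¬ (x ≈ 0#) → ∃ λ y → (x * y) ≈ 1#

data ℕ∞ : Set where
  fin : ℕ → ℕ∞
  ∞   : ℕ∞

infix 4 _≤∞_
data _≤∞_ : ℕ∞ → ℕ∞ → Set where
  fin≤fin : ∀ {a b} → a ≤ b → fin a ≤∞ fin b
  _≤∞∞    : ∀ a → a ≤∞ ∞

Pt : ℕ → Set
Pt n = Fin n → ℕ∞

infix 4 _≼_ _≐_
_≼_ : ∀ {n} → Pt n → Pt n → Set
a ≼ b = ∀ i → a i ≤∞ b i

_≐_ : ∀ {n} → Pt n → Pt n → Set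
a ≐ b = ∀ i → a i ≡ b i

isInf : ℕ∞ → Bool
isInf (fin _) = false
isInf ∞       = true

infpt : ∀ {n} → Pt n → Subset n
infpt a = tabulate (isInf ∘ a)

count : ∀ {n} → (Fin n → Bool) → ℕ
count {n} p = foldr (λ i k → if p i then suc k else k) 0 (allFin n)

#infpt : ∀ {n} → Pt n → ℕ
#infpt a = count (isInf ∘ a)

module _ {n : ℕ} (Γ : Pt n → Set) where

  IsMaximal : Pt n → Set
  IsMaximal m = Γ m × (∀ c → Γ c → m ≼ c → c ≐ m)

  IsMulticomplex : Set
  IsMulticomplex =
    (∀ a b → Γ b → a ≼ b → Γ a) ×
    (∀ a → Γ a → ∃ λ m → IsMaximal m × a ≼ m)

  IsFacet : Pt n → Set
  IsFacet a = Γ a × (∀ m → IsMaximal m → a ≼ m → infpt a ≡ infpt m)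

  InInterval : Pt n → Pt n → Pt n → Set
  InInterval a b c = Γ c × a ≼ c × c ≼ b

  IsPartition : (t : ℕ) → (Fin t → Pt n) → (Fin t → Pt n) → Set
  IsPartition t a b =
    (∀ k → Γ (a k) × Γ (b k) × a k ≼ b k) ×
    (∀ c → Γ c → ∃ λ k → InInterval (a k) (b k) c) ×
    (∀ c k k' → InInterval (a k) (b k) c → InInterval (a k') (b k') c → k ≡ k')

-- The polynomial ring S = K[x_1,…,x_n]: a polynomial is a finite formal
-- sum of terms c·x^e (list of (coefficient, exponent vector)); two
-- polynomials are equal iff all coefficients agree.

module Poly {c ℓ : Level} (K : Field c ℓ) (n : ℕ) where
  open Field K using (Carrier; 0#; 1#; _≈_) renaming (_+_ to _+K_; _*_ to _*K_)

  Mon : Set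
  Mon = Vec ℕ n

  P : Set c
  P = List (Carrier × Mon)

  coeff : P → Mon → Carrier
  coeff []            e = 0#
  coeff ((a , f) ∷ p) e =
    if does (VecP.≡-dec _≟ℕ_ f e) then a +K coeff p e else coeff p e

  infix 4 _≈P_
  _≈P_ : P → P → Set ℓ
  p ≈P q = ∀ e → coeff p e ≈ coeff q e

  _+P_ : P → P → P
  _+P_ = _++_

  _*P_ : P → P → P
  p *P q = concatMap (λ { (a , f) → map (λ { (b , g) → (a *K b , zipWith _+_ f g) }) q }) p

  1P : P
  1P = [ (1# , replicate n 0) ]

  monomial : Mon → P
  monomial e = [ (1# , e) ]

  var : Fin n → P
  var i = monomial (tabulate (λ j → if does (i Data.Fin.≟ j) then 1 else 0))

  lincomb : (gs : List P) → (Fin (length gs) → P) → P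
  lincomb []       h = []
  lincomb (g ∷ gs) h = (h zero *P g) +P lincomb gs (h ∘ suc)

  infix 4 _∈⟨_⟩
  _∈⟨_⟩ : P → List P → Set (c ⊔ ℓ)
  f ∈⟨ gs ⟩ = Σ (Fin (length gs) → P) λ h → f ≈P lincomb gs h

  𝔪 : List P
  𝔪 = map var (allFin n)

  IsRegSeq : List P → List P → Set (c ⊔ ℓ)
  IsRegSeq js []       = ¬ (1P ∈⟨ js ⟩)
  IsRegSeq js (f ∷ fs) =
    (f ∈⟨ 𝔪 ⟩) ×
    (∀ g → (f *P g) ∈⟨ js ⟩ → g ∈⟨ js ⟩) ×
    IsRegSeq (js ++ [ f ]) fs

  DepthS/≤ : List P → ℕ → Set (c ⊔ ℓ)
  DepthS/≤ js d = ∀ fs → IsRegSeq js fs → length fs ≤ d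

-- Monomial ideal data: I = (u_1,…,u_s), u_j = x^(A j), A j i = a_{ji}.

rmax : ∀ {s n} → (Fin s → Fin n → ℕ) → Fin n → ℕ
rmax {s} A i = foldr (λ j m → A j i ⊔ℕ m) 0 (allFin s)

MonInI : ∀ {s n} → (Fin s → Fin n → ℕ) → (Fin n → ℕ) → Set
MonInI {s} A d = ∃ λ (j : Fin s) → ∀ i → A j i ≤ d i

monGens : ∀ {c ℓ} (K : Field c ℓ) {s n : ℕ} → (Fin s → Fin n → ℕ) → List (Poly.P K n)
monGens K {s} {n} A = map (λ j → Poly.monomial K n (tabulate (A j))) (allFin s)

{-# OPTIONS --safe #-}
-- Suppose r_j ≤ a_k(j) and lower the j-th coordinate of a_k to r_j, obtaining c ∈ [a_l, b_l].
-- Since no generator needs more than r_j in the j-th exponent, the j-th coordinate of a point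
-- of Γ that is at least r_j can be raised arbitrarily, hence to ∞.  Applied to the facet b_l this forces b_l(j) = ∞,
-- as a maximal element above b_l must have the same infinite coordinates.  Then a_k ∈ [a_l, b_l]
-- as well, so l = k by disjointness, and a_k ≤ c gives a_k(j) ≤ r_j.
module Submission where

open import Defs
open import Level using (Level)
open import Data.Nat using (ℕ; suc; _≤_; _⊔_)
open import Data.Nat.Properties using (≤-refl; ≤-trans; ≤-total; m≤m⊔n; m≤n⊔m; <⇒≱)
open import Data.Fin using (Fin) renaming (_≟_ to _≟ᶠ_)
open import Data.Bool using (true)
open import Data.List using (foldr; allFin)
open import Data.List.Membership.Propositional using (_∈_)
open import Data.List.Membership.Propositional.Properties using (∈-allFin)
open import Data.List.Relation.Unary.Any using (here; there)
open import Data.Product using (∃; _,_; proj₁; proj₂)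
open import Data.Sum using (_⊎_; inj₁; inj₂; [_,_]′)
open import Data.Vec using (lookup)
open import Data.Vec.Properties using (lookup∘tabulate)
open import Data.Vec.Functional using (updateAt)
open import Data.Vec.Functional.Properties using (updateAt-updates; updateAt-minimal)
open import Data.Empty using (⊥-elim)
open import Relation.Nullary using (¬_; yes; no)
open import Relation.Binary.PropositionalEquality using (_≡_; refl; sym; trans; cong; subst)
open import Function using (_∘_; _⇔_; const)
open import Function.Bundles using (Equivalence)

open Equivalence using (to; from)

≤∞-refl : ∀ {x} → x ≤∞ x
≤∞-refl {fin x} = fin≤fin ≤-refl
≤∞-refl {∞}     = ∞ ≤∞∞

≤∞-trans : ∀ {x y z} → x ≤∞ y → y ≤∞ z → x ≤∞ z
≤∞-trans (fin≤fin x≤y) (fin≤fin y≤z) = fin≤fin (≤-trans x≤y y≤z)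
≤∞-trans {x}  _            (_ ≤∞∞)      = x ≤∞∞

≤∞-total-fin : ∀ x r → x ≤∞ fin r ⊎ fin r ≤∞ x
≤∞-total-fin (fin x) r with ≤-total x r
... | inj₁ x≤r = inj₁ (fin≤fin x≤r)
... | inj₂ r≤x = inj₂ (fin≤fin r≤x)
≤∞-total-fin ∞       r = inj₂ (fin r ≤∞∞)

∞≤∞⇒≡∞ : ∀ {x} → ∞ ≤∞ x → x ≡ ∞
∞≤∞⇒≡∞ (_ ≤∞∞) = refl

isInf≡true⇒≡∞ : ∀ {x} → isInf x ≡ true → x ≡ ∞
isInf≡true⇒≡∞ {∞} _ = refl

≼-refl : ∀ {n} {p : Pt n} → p ≼ p
≼-refl i = ≤∞-refl

≼-trans : ∀ {n} {p q r : Pt n} → p ≼ q → q ≼ r → p ≼ r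
≼-trans p≼q q≼r i = ≤∞-trans (p≼q i) (q≼r i)

infpt-isInf : ∀ {n} {p q : Pt n} → infpt p ≡ infpt q → ∀ i → isInf (p i) ≡ isInf (q i)
infpt-isInf {p = p} {q} eq i =
  trans (sym (lookup∘tabulate (isInf ∘ p) i))
        (trans (cong (λ v → lookup v i) eq) (lookup∘tabulate (isInf ∘ q) i))

infixl 6 _[_]≔_
_[_]≔_ : ∀ {n} → Pt n → Fin n → ℕ∞ → Pt n
p [ j ]≔ x = updateAt p j (const x)

[]≔-≼ : ∀ {n} {p : Pt n} {j x} → x ≤∞ p j → p [ j ]≔ x ≼ p
[]≔-≼ {p = p} {j} {x} x≤pj i with i ≟ᶠ j
... | yes refl rewrite updateAt-updates j {const x} p = x≤pj
... | no i≢j rewrite updateAt-minimal i j {const x} p i≢j = ≤∞-refl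

≼-[]≔ : ∀ {n} {p : Pt n} {j x} → p j ≤∞ x → p ≼ p [ j ]≔ x
≼-[]≔ {p = p} {j} {x} pj≤x i with i ≟ᶠ j
... | yes refl rewrite updateAt-updates j {const x} p = pj≤x
... | no i≢j rewrite updateAt-minimal i j {const x} p i≢j = ≤∞-refl

≼-via-[]≔ : ∀ {n} {p q : Pt n} {j x} → p [ j ]≔ x ≼ q → p j ≤∞ q j → p ≼ q
≼-via-[]≔ {p = p} {j = j} {x} p'≼q pj≤qj i with i ≟ᶠ j
... | yes refl = pj≤qj
... | no i≢j = subst (_≤∞ _) (updateAt-minimal i j {const x} p i≢j) (p'≼q i)

⊔-foldr-ub : ∀ {A : Set} (f : A → ℕ) {x xs} → x ∈ xs → f x ≤ foldr (λ y m → f y ⊔ m) 0 xs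
⊔-foldr-ub f (here refl) = m≤m⊔n _ _
⊔-foldr-ub f (there x∈xs) = ≤-trans (⊔-foldr-ub f x∈xs) (m≤n⊔m _ _)

maxOver : ∀ {m} → (Fin m → ℕ) → ℕ
maxOver {m} f = foldr (λ x acc → f x ⊔ acc) 0 (allFin m)

≤-maxOver : ∀ {m} (f : Fin m → ℕ) x → f x ≤ maxOver f
≤-maxOver f x = ⊔-foldr-ub f (∈-allFin x)

rmax-ub : ∀ {s n} (A : Fin s → Fin n → ℕ) j i → A j i ≤ rmax A i
rmax-ub A j i = ≤-maxOver (λ j → A j i) j

finPart : ℕ∞ → ℕ
finPart (fin x) = x
finPart ∞       = 0

cap : ℕ → ℕ∞ → ℕ
cap N (fin x) = x
cap N ∞       = N

cap-≤∞ : ∀ N x → fin (cap N x) ≤∞ x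
cap-≤∞ N (fin x) = ≤∞-refl
cap-≤∞ N ∞       = fin N ≤∞∞

FiniteEntriesBelow : ∀ {n} → ℕ → Pt n → Set
FiniteEntriesBelow N q = ∀ i → fin N ≤∞ q i → q i ≡ ∞

≤∞-uncap : ∀ {N} x {y} → (fin N ≤∞ y → y ≡ ∞) → fin (cap N x) ≤∞ y → x ≤∞ y
≤∞-uncap (fin x) big le = le
≤∞-uncap ∞       big le rewrite big le = ∞ ≤∞∞

finiteEntriesBelow-exists : ∀ {t n} (b : Fin t → Pt n) → ∃ λ N → ∀ k → FiniteEntriesBelow N (b k)
finiteEntriesBelow-exists b = suc B , λ k i → above (b k i) (≤-trans (≤-maxOver _ i) (≤-maxOver _ k))
  where
  B : ℕ
  B = maxOver (λ k → maxOver (λ i → finPart (b k i)))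

  above : ∀ x → finPart x ≤ B → fin (suc B) ≤∞ x → x ≡ ∞
  above (fin x) x≤B (fin≤fin B<x) = ⊥-elim (<⇒≱ B<x x≤B)
  above ∞       _   _             = refl

MonInI-transfer : ∀ {s n} (A : Fin s → Fin n → ℕ) {d e : Fin n → ℕ} →
  (∀ i → d i ≤ e i ⊎ rmax A i ≤ e i) → MonInI A d → MonInI A e
MonInI-transfer A d≲e (j , Aj≤d) =
  j , λ i → [ ≤-trans (Aj≤d i) , ≤-trans (rmax-ub A j i) ]′ (d≲e i)

module _ {s n} (A : Fin s → Fin n → ℕ) {Γ : Pt n → Set}
         (down : ∀ a b → Γ b → a ≼ b → Γ a)
         (assoc : ∀ d → Γ (fin ∘ d) ⇔ (¬ MonInI A d)) where

  Γ-transfer : ∀ {d e} → Γ (fin ∘ e) → (∀ i → d i ≤ e i ⊎ rmax A i ≤ e i) → Γ (fin ∘ d)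
  Γ-transfer {d} {e} Γe d≲e = from (assoc d) (to (assoc e) Γe ∘ MonInI-transfer A d≲e)

  Γ-cap-[]≔∞ : ∀ N {p j} → Γ p → fin (rmax A j) ≤∞ p j → Γ (fin ∘ cap N ∘ (p [ j ]≔ ∞))
  Γ-cap-[]≔∞ N {p} {j} Γp r≤pj = Γ-transfer Γe d≲e
    where
    lowered : Pt n
    lowered = p [ j ]≔ fin (rmax A j)

    Γe : Γ (fin ∘ cap N ∘ lowered)
    Γe = down _ p Γp (≼-trans (cap-≤∞ N ∘ lowered) ([]≔-≼ r≤pj))

    d≲e : ∀ i → cap N ((p [ j ]≔ ∞) i) ≤ cap N (lowered i) ⊎ rmax A i ≤ cap N (lowered i)
    d≲e i with i ≟ᶠ j
    ... | yes refl rewrite updateAt-updates j {const (fin (rmax A j))} p = inj₂ ≤-refl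
    ... | no i≢j rewrite updateAt-minimal i j {const ∞} p i≢j
                       | updateAt-minimal i j {const (fin (rmax A j))} p i≢j = inj₁ ≤-refl

  -- Γ is covered by the finitely many boxes below the b k, so a large finite value stands in for ∞.
  Γ-[]≔∞ : ∀ {t} {a b : Fin t → Pt n} → IsPartition Γ t a b →
    ∀ {p j} → Γ p → fin (rmax A j) ≤∞ p j → Γ (p [ j ]≔ ∞)
  Γ-[]≔∞ {b = b} (intervals , cover , _) {p} {j} Γp r≤pj
    with finiteEntriesBelow-exists b
  ... | N , bounded with cover _ (Γ-cap-[]≔∞ N Γp r≤pj)
  ... | k , _ , _ , capped≼bk =
    down _ (b k) (proj₁ (proj₂ (intervals k))) λ i → ≤∞-uncap _ (bounded k i) (capped≼bk i)

facet-[]≔∞ : ∀ {n} {Γ : Pt n → Set} → IsMulticomplex Γ →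
  ∀ {x j} → IsFacet Γ x → Γ (x [ j ]≔ ∞) → x j ≡ ∞
facet-[]≔∞ (_ , maximal-above) {x} {j} (_ , facet) Γx'
  with maximal-above (x [ j ]≔ ∞) Γx'
... | m , m-max , x'≼m = isInf≡true⇒≡∞ (trans (infpt-isInf same-infpt j) (cong isInf mj≡∞))
  where
  same-infpt : infpt x ≡ infpt m
  same-infpt = facet m m-max (≼-trans (≼-[]≔ (x j ≤∞∞)) x'≼m)

  mj≡∞ : m j ≡ ∞
  mj≡∞ = ∞≤∞⇒≡∞ (subst (_≤∞ m j) (updateAt-updates j x) (x'≼m j))

corner-≼ : ∀ {n} {Γ : Pt n → Set} {t} {a b : Fin t → Pt n} → IsPartition Γ t a b →
  ∀ {c k l} → c ≼ a k → InInterval Γ (a l) (b l) c → a k ≼ b l → a k ≼ c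
corner-≼ {Γ = Γ} {a = a} (intervals , _ , disjoint) {c} {k} {l} c≼ak (_ , al≼c , _) ak≼bl =
  subst (λ l → a l ≼ c) l≡k al≼c
  where
  Γak : Γ (a k)
  Γak = proj₁ (intervals k)

  l≡k : l ≡ k
  l≡k = disjoint _ l k (Γak , ≼-trans al≼c c≼ak , ak≼bl) (Γak , ≼-refl , proj₂ (proj₂ (intervals k)))

lemma2p2 : ∀ {c ℓ : Level} (K : Field c ℓ) (n s : ℕ) (A : Fin s → Fin n → ℕ) →
    -- each variable x_i divides some generator u_j = x^(A j)
    (∀ i → ∃ λ j → 1 ≤ A j i) →
    -- Γ is the multicomplex associated to I = (u_1, …, u_s)
    (Γ : Pt n → Set) → IsMulticomplex Γ →
    (∀ d → Γ (fin ∘ d) ⇔ (¬ MonInI A d)) →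
    -- Γ = ⋃_{k} [a k, b k] is a partition ...
    (t : ℕ) (a b : Fin t → Pt n) → IsPartition Γ t a b →
    -- ... with 𝓕(Γ) = {b 1, …, b t} ...
    (∀ x → IsFacet Γ x ⇔ (∃ λ k → b k ≐ x)) →
    -- ... which is nice: depth(S/I) ≤ |infpt(b k)| for all k
    (∀ k → Poly.DepthS/≤ K n (monGens K A) (#infpt (b k))) →
    ∀ k j → a k j ≤∞ fin (rmax A j)
lemma2p2 K n s A _ Γ mc assoc t a b part facets _ k j
  with ≤∞-total-fin (a k j) (rmax A j)
... | inj₁ ak≤r = ak≤r
... | inj₂ r≤ak = subst (a k j ≤∞_) (updateAt-updates j (a k)) (ak≼c j)
  where
  down : ∀ p q → Γ q → p ≼ q → Γ p
  down = proj₁ mc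

  c : Pt n
  c = a k [ j ]≔ fin (rmax A j)

  c≼ak : c ≼ a k
  c≼ak = []≔-≼ r≤ak

  c-covered : ∃ λ l → InInterval Γ (a l) (b l) c
  c-covered = proj₁ (proj₂ part) c (down c (a k) (proj₁ (proj₁ part k)) c≼ak)

  l : Fin t
  l = proj₁ c-covered

  c≼bl : c ≼ b l
  c≼bl = proj₂ (proj₂ (proj₂ c-covered))

  bl-facet : IsFacet Γ (b l)
  bl-facet = from (facets (b l)) (l , λ _ → refl)

  blj≡∞ : b l j ≡ ∞
  blj≡∞ = facet-[]≔∞ mc bl-facet (Γ-[]≔∞ A down assoc part (proj₁ bl-facet)
            (subst (_≤∞ b l j) (updateAt-updates j (a k)) (c≼bl j)))

  ak≼c : a k ≼ c
  ak≼c = corner-≼ part c≼ak (proj₂ c-covered)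
           (≼-via-[]≔ c≼bl (subst (a k j ≤∞_) (sym blj≡∞) (a k j ≤∞∞)))
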